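{- For $n\ge1$, let $\mathcal L([2]\times[n])$ be the set of linear extensions of $[2]\times[n]$ written as words via the labeling $(p,j)\mapsto p+2(j-1)$. Then $$\sum_{\sigma\in\mathcal L([2]\times[n])}x^{\mathrm{des}(\sigma)}=\sum_{D\in D_n}x^{\mathrm{hpea}(D)}.$$ (The right-hand side is the Narayana polynomial $N_n(x)$.)
   Context: $[2]\times[n]$ carries the product order $(p,j)\le(p',j')$ iff $p\le p'$ and $j\le j'$. A linear extension is a listing of all elements compatible with the order; as a word of labels $\sigma_1\cdots\sigma_{2n}$, its descents are positions $i$ with $\sigma_{i+1}<\sigma_i$. $D_n$ is the set of lattice paths from $(0,0)$ to $(n,n)$ with steps $e=(1,0)$, $n=(0,1)$ never going above $y=x$. A peak is two consecutive steps $e$ then $n$; it is low if the $e$ step starts on the diagonal, high otherwise; $\mathrm{hpea}(D)$ counts high peaks. -}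

module Defs where

open import Data.Bool using (Bool; true; false; _∧_; not; T; if_then_else_)
open import Data.Nat using (ℕ; zero; suc; _+_; _*_; _≡ᵇ_; _<ᵇ_; _≤ᵇ_)
open import Data.Fin using (Fin; toℕ)
open import Data.Fin.Properties using () renaming (_≟_ to _≟ᶠ_)
open import Data.Product using (Σ; _×_; _,_)
open import Data.List using (List; []; _∷_; length; allFin; map; cartesianProduct)
open import Data.Bool.ListAction using (and)
open import Relation.Nullary.Decidable using (⌊_⌋)

-- The poset [2] × [n].  An element (p , j) : Fin 2 × Fin n stands for
-- the pair (toℕ p + 1 , toℕ j + 1) ∈ [2] × [n].

Elem : ℕ → Set
Elem n = Fin 2 × Fin n

allElems : (n : ℕ) → List (Elem n)
allElems n = cartesianProduct (allFin 2) (allFin n)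

_≼ᵇ_ : {n : ℕ} → Elem n → Elem n → Bool
(p , j) ≼ᵇ (p' , j') = (toℕ p ≤ᵇ toℕ p') ∧ (toℕ j ≤ᵇ toℕ j')

_==ᵇ_ : {n : ℕ} → Elem n → Elem n → Bool
(p , j) ==ᵇ (p' , j') = ⌊ p ≟ᶠ p' ⌋ ∧ ⌊ j ≟ᶠ j' ⌋

_≺ᵇ_ : {n : ℕ} → Elem n → Elem n → Bool
x ≺ᵇ y = (x ≼ᵇ y) ∧ not (x ==ᵇ y)

label : {n : ℕ} → Elem n → ℕ
label (p , j) = (toℕ p + 1) + 2 * toℕ j

occ : {n : ℕ} → Elem n → List (Elem n) → ℕ
occ x [] = 0
occ x (y ∷ ys) = (if x ==ᵇ y then 1 else 0) + occ x ys

compatible : {n : ℕ} → List (Elem n) → Bool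
compatible [] = true
compatible (x ∷ xs) = and (map (λ y → not (y ≺ᵇ x)) xs) ∧ compatible xs

isLinExt : (n : ℕ) → List (Elem n) → Bool
isLinExt n w = and (map (λ x → occ x w ≡ᵇ 1) (allElems n))
             ∧ (length w ≡ᵇ 2 * n)
             ∧ compatible w

LinExt : ℕ → Set
LinExt n = Σ (List (Elem n)) (λ w → T (isLinExt n w))

desW : {n : ℕ} → List (Elem n) → ℕ
desW [] = 0
desW (x ∷ []) = 0
desW (x ∷ y ∷ ys) = (if label y <ᵇ label x then 1 else 0) + desW (y ∷ ys)

des : {n : ℕ} → LinExt n → ℕ
des (w , _) = desW w

-- Dyck paths D_n: words in e = (1,0), n = (0,1) from (0,0) to (n,n)
-- never going above y = x.

data Step : Set where
  E N : Step

-- h = (x - y) before reading the rest; path must stay with h ≥ 0 and end at 0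
staysBelow : ℕ → List Step → Bool
staysBelow h [] = h ≡ᵇ 0
staysBelow h (E ∷ s) = staysBelow (suc h) s
staysBelow zero (N ∷ s) = false
staysBelow (suc h) (N ∷ s) = staysBelow h s

isDyck : (n : ℕ) → List Step → Bool
isDyck n s = (length s ≡ᵇ 2 * n) ∧ staysBelow 0 s

Dyck : ℕ → Set
Dyck n = Σ (List Step) (λ s → T (isDyck n s))

-- 1 if an E step taken at height h (starting off the diagonal, h > 0)
-- is followed by an N step, i.e. forms a high peak
highPeakHere : ℕ → List Step → ℕ
highPeakHere (suc h) (N ∷ _) = 1
highPeakHere _ _ = 0

hpeaW : ℕ → List Step → ℕ
hpeaW h [] = 0
hpeaW h (E ∷ s) = highPeakHere h s + hpeaW (suc h) s
hpeaW zero (N ∷ s) = hpeaW zero s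
hpeaW (suc h) (N ∷ s) = hpeaW h s

hpea : {n : ℕ} → Dyck n → ℕ
hpea (s , _) = hpeaW 0 s

module Submission where

-- Reading a linear extension of [2] × [n] row by row (E for a cell of the bottom row, N for one
-- of the top row) gives a Dyck path: by compatibility the j-th top cell comes after the j-th
-- bottom cell.  The path determines the extension, because each row has to be listed from left
-- to right; so the extension is recovered by "placing" the leftmost unplaced cell of the row
-- named by each step.  Bottom cells carry the odd labels 2j − 1 and top cells the even labels
-- 2j.  Two consecutive cells of one row never form a descent, nor does a top cell followed by a
-- bottom one; a bottom cell (1, j) followed by a top cell (2, j′) is a descent iff j′ < j, i.e.
-- iff the E step placing (1, j) started off the diagonal.  So descents are exactly high peaks.

open import Defs
open import Data.Nat using (ℕ; _≤_)
open import Data.Product using (Σ)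
open import Relation.Binary.PropositionalEquality using (_≡_)
open import Function.Bundles using (_↔_)

open import Data.Bool using (Bool; true; false; _∧_; not; T; if_then_else_)
open import Data.Bool.ListAction using (all)
open import Data.Bool.Properties using (T-∧; T-≡; T-not-≡; T-irrelevant)
open import Data.Empty using (⊥; ⊥-elim)
open import Data.Fin using (Fin; toℕ) renaming (zero to fzero; suc to fsuc)
open import Data.Fin.Properties using (toℕ≤pred[n]) renaming (_≟_ to _≟ᶠ_)
open import Data.List using (List; []; _∷_; length; map)
open import Data.List.Properties using (length-map)
open import Data.List.Membership.Propositional using (_∈_)
open import Data.List.Membership.Propositional.Properties using (∈-cartesianProduct⁺; ∈-allFin)
open import Data.List.Relation.Unary.All as All using ()
open import Data.List.Relation.Unary.All.Properties using (all⁺; all⁻)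
open import Data.List.Relation.Unary.Any using (here; there)
open import Data.Nat using (zero; suc; pred; _+_; _*_; _<_; _≡ᵇ_; _<ᵇ_; _≤ᵇ_; z≤n; s≤s)
open import Data.Nat.Properties
open import Data.Product using (_×_; _,_; proj₁; proj₂)
open import Data.Product.Function.Dependent.Propositional using (Σ-↔)
open import Data.Unit using (tt)
open import Function.Base using (_∘_)
open import Function.Bundles using (Equivalence; Inverse; mk↔ₛ′)
open import Function.Properties.Inverse using (↔-refl)
open import Relation.Binary.PropositionalEquality
  using (_≢_; refl; sym; trans; cong; cong₂; subst; module ≡-Reasoning)
open import Relation.Nullary using (¬_; yes; no; contradiction)
open import Relation.Nullary.Decidable using (⌊_⌋)

𝟙 : Bool → ℕ
𝟙 b = if b then 1 else 0

𝟙≢0⇒T : ∀ {b} → 𝟙 b ≢ 0 → T b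
𝟙≢0⇒T {true}  _   = tt
𝟙≢0⇒T {false} 𝟙≢0 = contradiction refl 𝟙≢0

T⇒𝟙≡1 : ∀ {b} → T b → 𝟙 b ≡ 1
T⇒𝟙≡1 {true} _ = refl

∧-intro : ∀ {x y} → T x → T y → T (x ∧ y)
∧-intro p q = Equivalence.from T-∧ (p , q)

∧-elim : ∀ {x y} → T (x ∧ y) → T x × T y
∧-elim = Equivalence.to T-∧

subset-≡ : ∀ {A : Set} {P : A → Bool} {a b : A} {p : T (P a)} {q : T (P b)} →
           a ≡ b → _≡_ {A = Σ A (T ∘ P)} (a , p) (b , q)
subset-≡ {a = a} {p = p} {q} refl = cong (a ,_) (T-irrelevant p q)

≡-↔ : ∀ {a b k : ℕ} → a ≡ b → (a ≡ k) ↔ (b ≡ k)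
≡-↔ refl = ↔-refl

<ᵇ-suc : ∀ k a → (k <ᵇ suc a) ≡ (k ≤ᵇ a)
<ᵇ-suc zero    a = refl
<ᵇ-suc (suc k) a = refl

≤ᵇ-split : ∀ c k → 𝟙 (k ≡ᵇ c) + 𝟙 (suc c ≤ᵇ k) ≡ 𝟙 (c ≤ᵇ k)
≤ᵇ-split zero    zero    = refl
≤ᵇ-split zero    (suc k) = refl
≤ᵇ-split (suc c) zero    = refl
≤ᵇ-split (suc c) (suc k) rewrite <ᵇ-suc c k = ≤ᵇ-split c k

𝟙-≰ᵇ : ∀ {c k} → c < k → 𝟙 (k ≤ᵇ c) ≡ 0
𝟙-≰ᵇ {c} {k} c<k with k ≤ᵇ c in k≤c
... | true  = contradiction (≤ᵇ⇒≤ k c (Equivalence.from T-≡ k≤c)) (<⇒≱ c<k)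
... | false = refl

𝟙-<ᵇ : ∀ {a b} → a < b → 𝟙 (a <ᵇ b) ≡ 1
𝟙-<ᵇ a<b = T⇒𝟙≡1 (<⇒<ᵇ a<b)

𝟙-<ᵇ-cong : ∀ {a a′ b b′} → a ≡ a′ → b ≡ b′ → 𝟙 (a <ᵇ b) ≡ 𝟙 (a′ <ᵇ b′)
𝟙-<ᵇ-cong = cong₂ (λ a b → 𝟙 (a <ᵇ b))

𝟙-≮ᵇ : ∀ {a b} → ¬ a < b → 𝟙 (a <ᵇ b) ≡ 0
𝟙-≮ᵇ {a} {b} a≮b with a <ᵇ b in a<b
... | true  = contradiction (<ᵇ⇒< a b (Equivalence.from T-≡ a<b)) a≮b
... | false = refl

⌊≟ᶠ⌋≡≡ᵇ : ∀ {n} (i j : Fin n) → ⌊ i ≟ᶠ j ⌋ ≡ (toℕ i ≡ᵇ toℕ j)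
⌊≟ᶠ⌋≡≡ᵇ fzero    fzero    = refl
⌊≟ᶠ⌋≡≡ᵇ fzero    (fsuc j) = refl
⌊≟ᶠ⌋≡≡ᵇ (fsuc i) fzero    = refl
⌊≟ᶠ⌋≡≡ᵇ (fsuc i) (fsuc j) with i ≟ᶠ j | ⌊≟ᶠ⌋≡≡ᵇ i j
... | yes _ | i≡ᵇj = i≡ᵇj
... | no  _ | i≡ᵇj = i≡ᵇj

≟ᶠ-≤ᵇ-split : ∀ {n} (i j : Fin n) {c} → toℕ j ≡ c →
               𝟙 ⌊ i ≟ᶠ j ⌋ + 𝟙 (suc c ≤ᵇ toℕ i) ≡ 𝟙 (c ≤ᵇ toℕ i)
≟ᶠ-≤ᵇ-split i j refl rewrite ⌊≟ᶠ⌋≡≡ᵇ i j = ≤ᵇ-split (toℕ j) (toℕ i)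

-- Saturating conversion; only ever applied to values ≤ m, where it is exact.
clamp : (m : ℕ) → ℕ → Fin (suc m)
clamp m       zero    = fzero
clamp zero    (suc c) = fzero
clamp (suc m) (suc c) = fsuc (clamp m c)

toℕ-clamp : ∀ m {c} → c ≤ m → toℕ (clamp m c) ≡ c
toℕ-clamp m       z≤n       = refl
toℕ-clamp (suc m) (s≤s c≤m) = cong suc (toℕ-clamp m c≤m)

==ᵇ-refl : ∀ {n} (x : Elem n) → T (x ==ᵇ x)
==ᵇ-refl (p , j) with p ≟ᶠ p | j ≟ᶠ j
... | yes _   | yes _   = tt
... | no  p≢p | _       = contradiction refl p≢p
... | yes _   | no  j≢j = contradiction refl j≢j

==ᵇ⇒≡ : ∀ {n} (x y : Elem n) → T (x ==ᵇ y) → x ≡ y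
==ᵇ⇒≡ (p , j) (q , i) x==y with p ≟ᶠ q | j ≟ᶠ i | x==y
... | yes refl | yes refl | _ = refl
... | yes _    | no  _    | ()
... | no  _    | _        | ()

occ-head : ∀ {n} (x : Elem n) t → occ x (x ∷ t) ≡ suc (occ x t)
occ-head x t rewrite Equivalence.to T-≡ (==ᵇ-refl x) = refl

occ≢0⇒∈ : ∀ {n} {z : Elem n} t → occ z t ≢ 0 → z ∈ t
occ≢0⇒∈ []      occ≢0 = contradiction refl occ≢0
occ≢0⇒∈ {z = z} (x ∷ t) occ≢0 with z ==ᵇ x in z==x
... | true  = here (==ᵇ⇒≡ z x (Equivalence.from T-≡ z==x))
... | false = there (occ≢0⇒∈ t occ≢0)

∈⇒occ≢0 : ∀ {n} {z : Elem n} {t} → z ∈ t → occ z t ≢ 0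
∈⇒occ≢0 {z = z} {.z ∷ t} (here refl) rewrite occ-head z t = λ ()
∈⇒occ≢0 {z = z} {x ∷ t}  (there z∈t) = ∈⇒occ≢0 z∈t ∘ m+n≡0⇒n≡0 (𝟙 (z ==ᵇ x))

≺ᵇ-intro : ∀ {n} {z x : Elem n} → T (z ≼ᵇ x) → (z ==ᵇ x) ≡ false → T (z ≺ᵇ x)
≺ᵇ-intro z≼x z≠x rewrite z≠x = ∧-intro z≼x tt

⋠ᵇ⇒⊀ᵇ : ∀ {n} {z x : Elem n} → ¬ T (z ≼ᵇ x) → T (not (z ≺ᵇ x))
⋠ᵇ⇒⊀ᵇ {z = z} {x} z⋠x with z ≼ᵇ x
... | true  = contradiction tt z⋠x
... | false = tt

compatible-∷ : ∀ {n} {x : Elem n} {t} → (∀ {z} → z ∈ t → ¬ T (z ≼ᵇ x)) →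
               T (compatible t) → T (compatible (x ∷ t))
compatible-∷ {x = x} {t} above compatible-t =
  ∧-intro (all⁻ _ (All.tabulate (λ {z} z∈t → ⋠ᵇ⇒⊀ᵇ {z = z} {x} (above z∈t)))) compatible-t

compatible-tail : ∀ {n} (x : Elem n) t → T (compatible (x ∷ t)) → T (compatible t)
compatible-tail x t c = proj₂ (∧-elim {all (λ z → not (z ≺ᵇ x)) t} c)

compatible-head-minimal : ∀ {n} {x z : Elem n} {t} → T (compatible (x ∷ t)) →
                          z ∈ x ∷ t → T (z ≼ᵇ x) → z ≡ x
compatible-head-minimal c (here z≡x) _ = z≡x
compatible-head-minimal {x = x} {z} {t} c (there z∈t) z≼x with z ==ᵇ x in z==x
... | true  = ==ᵇ⇒≡ z x (Equivalence.from T-≡ z==x)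
... | false = contradiction (≺ᵇ-intro {z = z} {x} z≼x z==x) (subst T z⊀x)
  where
    z⊀x : (z ≺ᵇ x) ≡ false
    z⊀x = Equivalence.to T-not-≡ (All.lookup (all⁺ _ t (proj₁ (∧-elim c))) z∈t)

module _ (n : ℕ) (w : List (Elem n)) where

  private
    eachOnce = all (λ x → occ x w ≡ᵇ 1) (allElems n)
    length2n = length w ≡ᵇ 2 * n

  isLinExt⁻ : T (isLinExt n w) → (∀ x → occ x w ≡ 1) × length w ≡ 2 * n × T (compatible w)
  isLinExt⁻ p = occ≡1 , ≡ᵇ⇒≡ (length w) (2 * n) (proj₁ rest) , proj₂ rest
    where
      parts = ∧-elim {eachOnce} p
      rest  = ∧-elim {length2n} (proj₂ parts)
      occ≡1 : ∀ x → occ x w ≡ 1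
      occ≡1 (p , j) = ≡ᵇ⇒≡ _ 1 (All.lookup (all⁺ _ (allElems n) (proj₁ parts))
                                           (∈-cartesianProduct⁺ (∈-allFin p) (∈-allFin j)))

  isLinExt⁺ : (∀ x → occ x w ≡ 1) → length w ≡ 2 * n → T (compatible w) → T (isLinExt n w)
  isLinExt⁺ occ≡1 length≡ compatible-w =
    ∧-intro {eachOnce} (all⁻ _ {allElems n} (All.tabulate λ {x} _ → ≡⇒≡ᵇ (occ x w) 1 (occ≡1 x)))
            (∧-intro {length2n} (≡⇒≡ᵇ (length w) (2 * n) length≡) compatible-w)

module _ (n : ℕ) (s : List Step) where

  isDyck⁻ : T (isDyck n s) → length s ≡ 2 * n × T (staysBelow 0 s)
  isDyck⁻ p = ≡ᵇ⇒≡ (length s) (2 * n) (proj₁ parts) , proj₂ parts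
    where parts = ∧-elim {length s ≡ᵇ 2 * n} p

  isDyck⁺ : length s ≡ 2 * n → T (staysBelow 0 s) → T (isDyck n s)
  isDyck⁺ length≡ below = ∧-intro {length s ≡ᵇ 2 * n} (≡⇒≡ᵇ (length s) (2 * n) length≡) below

eastSteps northSteps : List Step → ℕ
eastSteps []      = 0
eastSteps (E ∷ s) = suc (eastSteps s)
eastSteps (N ∷ s) = eastSteps s
northSteps []      = 0
northSteps (E ∷ s) = northSteps s
northSteps (N ∷ s) = suc (northSteps s)

length≡east+north : ∀ s → length s ≡ eastSteps s + northSteps s
length≡east+north []      = refl
length≡east+north (E ∷ s) = cong suc (length≡east+north s)
length≡east+north (N ∷ s) =
  trans (cong suc (length≡east+north s)) (sym (+-suc (eastSteps s) (northSteps s)))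

staysBelow⇒east+h≡north : ∀ h s → T (staysBelow h s) → eastSteps s + h ≡ northSteps s
staysBelow⇒east+h≡north zero    []      _     = refl
staysBelow⇒east+h≡north h       (E ∷ s) below =
  trans (sym (+-suc (eastSteps s) h)) (staysBelow⇒east+h≡north (suc h) s below)
staysBelow⇒east+h≡north (suc h) (N ∷ s) below =
  trans (+-suc (eastSteps s) h) (cong suc (staysBelow⇒east+h≡north h s below))

dyck-northSteps : ∀ n s → T (isDyck n s) → northSteps s ≡ n
dyck-northSteps n s p = *-cancelˡ-≡ (northSteps s) n 2 (begin
    northSteps s + (northSteps s + 0)  ≡⟨ cong (_+ (northSteps s + 0)) (sym east≡north) ⟩
    eastSteps s + (northSteps s + 0)   ≡⟨ cong (eastSteps s +_) (+-identityʳ _) ⟩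
    eastSteps s + northSteps s         ≡⟨ sym (length≡east+north s) ⟩
    length s                           ≡⟨ proj₁ (isDyck⁻ n s p) ⟩
    2 * n                              ∎)
  where
    open ≡-Reasoning
    east≡north : eastSteps s ≡ northSteps s
    east≡north = trans (sym (+-identityʳ _)) (staysBelow⇒east+h≡north 0 s (proj₂ (isDyck⁻ n s p)))

-- The hypothesis y + northSteps s ≡ suc m: the rest s of a path at (h + y , y) ends on the line y = suc m.
east-bound : ∀ m h y s → T (staysBelow (suc h) s) → y + northSteps s ≡ suc m → h + y ≤ m
east-bound m h y s below ends = ≤-pred (begin
  suc h + y                  ≤⟨ m≤n+m (suc h + y) (eastSteps s) ⟩
  eastSteps s + (suc h + y)  ≡⟨ sym (+-assoc (eastSteps s) (suc h) y) ⟩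
  eastSteps s + suc h + y    ≡⟨ cong (_+ y) (staysBelow⇒east+h≡north (suc h) s below) ⟩
  northSteps s + y           ≡⟨ +-comm (northSteps s) y ⟩
  y + northSteps s           ≡⟨ ends ⟩
  suc m                      ∎)
  where open ≤-Reasoning

north-bound : ∀ m y s → y + northSteps (N ∷ s) ≡ suc m → y ≤ m
north-bound m y s ends =
  ≤-pred (subst (suc y ≤_) ends (≤-trans (m≤m+n (suc y) (northSteps s))
                                          (≤-reflexive (sym (+-suc y (northSteps s))))))

headDescent : ∀ {n} → Elem n → List (Elem n) → ℕ
headDescent x []      = 0
headDescent x (y ∷ _) = 𝟙 (label y <ᵇ label x)

desW-∷ : ∀ {n} (x : Elem n) xs → desW (x ∷ xs) ≡ headDescent x xs + desW xs
desW-∷ x []      = refl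
desW-∷ x (y ∷ _) = refl

highPeakHere-E : ∀ h s → highPeakHere h (E ∷ s) ≡ 0
highPeakHere-E zero    s = refl
highPeakHere-E (suc h) s = refl

pattern 0F = fzero
pattern 1F = fsuc fzero

module Extensions (m : ℕ) where

  Cell : Set
  Cell = Elem (suc m)

  bottom top : ℕ → Cell
  bottom c = 0F , clamp m c
  top    c = 1F , clamp m c

  row : Cell → Step
  row (0F , _) = E
  row (1F , _) = N

  -- The state (h , y) is the lattice point (h + y , y) of the path; h is its height x − y.
  place : ℕ → ℕ → List Step → List Cell
  place h y []      = []
  place h y (E ∷ s) = bottom (h + y) ∷ place (suc h) y s
  place h y (N ∷ s) = top y ∷ place (pred h) (suc y) s

  rows-place : ∀ h y s → map row (place h y s) ≡ s
  rows-place h y []      = refl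
  rows-place h y (E ∷ s) = cong (E ∷_) (rows-place (suc h) y s)
  rows-place h y (N ∷ s) = cong (N ∷_) (rows-place (pred h) (suc y) s)

  length-place : ∀ h y s → length (place h y s) ≡ length s
  length-place h y []      = refl
  length-place h y (E ∷ s) = cong suc (length-place (suc h) y s)
  length-place h y (N ∷ s) = cong suc (length-place (pred h) (suc y) s)

  unplaced : ℕ → ℕ → Cell → Bool
  unplaced h y (0F , j) = h + y ≤ᵇ toℕ j
  unplaced h y (1F , j) = y ≤ᵇ toℕ j

  Enumerates : ℕ → ℕ → List Cell → Set
  Enumerates h y xs = ∀ z → occ z xs ≡ 𝟙 (unplaced h y z)

  Removes : ℕ → ℕ → Cell → ℕ → ℕ → Set
  Removes h y x h′ y′ = ∀ z → 𝟙 (z ==ᵇ x) + 𝟙 (unplaced h′ y′ z) ≡ 𝟙 (unplaced h y z)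

  removes-bottom : ∀ h y → h + y ≤ m → Removes h y (bottom (h + y)) (suc h) y
  removes-bottom h y c≤m (0F , i) = ≟ᶠ-≤ᵇ-split i (clamp m (h + y)) (toℕ-clamp m c≤m)
  removes-bottom h y c≤m (1F , i) = refl

  removes-top : ∀ h y → y ≤ m → Removes (suc h) y (top y) h (suc y)
  removes-top h y y≤m (0F , i) = cong (λ c → 𝟙 (c ≤ᵇ toℕ i)) (+-suc h y)
  removes-top h y y≤m (1F , i) = ≟ᶠ-≤ᵇ-split i (clamp m y) (toℕ-clamp m y≤m)

  Enumerates-∷ : ∀ {h y x h′ y′ t} → Removes h y x h′ y′ →
                 Enumerates h′ y′ t → Enumerates h y (x ∷ t)
  Enumerates-∷ {x = x} removes enum z = trans (cong (𝟙 (z ==ᵇ x) +_) (enum z)) (removes z)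

  Enumerates-tail : ∀ {h y x h′ y′ t} → Removes h y x h′ y′ →
                    Enumerates h y (x ∷ t) → Enumerates h′ y′ t
  Enumerates-tail {x = x} removes enum z =
    +-cancelˡ-≡ (𝟙 (z ==ᵇ x)) _ _ (trans (enum z) (sym (removes z)))

  unplaced-origin : ∀ z → 𝟙 (unplaced 0 0 z) ≡ 1
  unplaced-origin (0F , j) = refl
  unplaced-origin (1F , j) = refl

  unplaced-beyond : ∀ h y → m < y → ∀ z → 𝟙 (unplaced h y z) ≡ 0
  unplaced-beyond h y m<y (0F , i) = 𝟙-≰ᵇ (≤-<-trans (toℕ≤pred[n] i) (≤-trans m<y (m≤n+m y h)))
  unplaced-beyond h y m<y (1F , i) = 𝟙-≰ᵇ (≤-<-trans (toℕ≤pred[n] i) m<y)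

  bottom-unplaced : ∀ {h y} → h + y ≤ m → T (unplaced h y (bottom (h + y)))
  bottom-unplaced c≤m = ≤⇒≤ᵇ (≤-reflexive (sym (toℕ-clamp m c≤m)))

  top-unplaced : ∀ {h y} → y ≤ m → T (unplaced h y (top y))
  top-unplaced y≤m = ≤⇒≤ᵇ (≤-reflexive (sym (toℕ-clamp m y≤m)))

  ∈-unplaced : ∀ {h y xs z} → Enumerates h y xs → z ∈ xs → T (unplaced h y z)
  ∈-unplaced {z = z} enum z∈xs = 𝟙≢0⇒T (λ 𝟙≡0 → ∈⇒occ≢0 z∈xs (trans (enum z) 𝟙≡0))

  enumerates-place : ∀ h y s → T (staysBelow h s) → y + northSteps s ≡ suc m →
                     Enumerates h y (place h y s)
  enumerates-place zero    y []      _     ends z = sym (unplaced-beyond 0 y m<y z)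
    where m<y = ≤-reflexive (trans (sym ends) (+-identityʳ y))
  enumerates-place h       y (E ∷ s) below ends =
    Enumerates-∷ {t = place (suc h) y s} (removes-bottom h y (east-bound m h y s below ends))
                 (enumerates-place (suc h) y s below ends)
  enumerates-place (suc h) y (N ∷ s) below ends =
    Enumerates-∷ {t = place h (suc y) s} (removes-top h y (north-bound m y s ends))
                 (enumerates-place h (suc y) s below (trans (sym (+-suc y (northSteps s))) ends))

  unplaced⇒⋠bottom : ∀ {h y} z → h + y ≤ m → T (unplaced (suc h) y z) →
                     ¬ T (z ≼ᵇ bottom (h + y))
  unplaced⇒⋠bottom (0F , i) c≤m beyond below =
    <⇒≱ (≤ᵇ⇒≤ _ _ beyond) (subst (toℕ i ≤_) (toℕ-clamp m c≤m) (≤ᵇ⇒≤ _ _ below))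
  unplaced⇒⋠bottom (1F , i) c≤m beyond ()

  unplaced⇒⋠top : ∀ {h y} z → y ≤ m → T (unplaced h (suc y) z) → ¬ T (z ≼ᵇ top y)
  unplaced⇒⋠top {h} {y} (0F , i) y≤m beyond below =
    <⇒≱ (≤-trans (m≤n+m (suc y) h) (≤ᵇ⇒≤ _ _ beyond))
        (subst (toℕ i ≤_) (toℕ-clamp m y≤m) (≤ᵇ⇒≤ _ _ below))
  unplaced⇒⋠top (1F , i) y≤m beyond below =
    <⇒≱ (≤ᵇ⇒≤ _ _ beyond) (subst (toℕ i ≤_) (toℕ-clamp m y≤m) (≤ᵇ⇒≤ _ _ below))

  compatible-place : ∀ h y s → T (staysBelow h s) → y + northSteps s ≡ suc m →
                     T (compatible (place h y s))
  compatible-place h       y []      _     _    = tt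
  compatible-place h       y (E ∷ s) below ends =
    compatible-∷ {x = bottom (h + y)} {place (suc h) y s}
      (λ {z} z∈t → unplaced⇒⋠bottom z (east-bound m h y s below ends)
                     (∈-unplaced (enumerates-place (suc h) y s below ends) z∈t))
      (compatible-place (suc h) y s below ends)
  compatible-place (suc h) y (N ∷ s) below ends =
    compatible-∷ {x = top y} {place h (suc y) s}
      (λ {z} z∈t → unplaced⇒⋠top z (north-bound m y s ends)
                     (∈-unplaced (enumerates-place h (suc y) s below ends′) z∈t))
      (compatible-place h (suc y) s below ends′)
    where ends′ = trans (sym (+-suc y (northSteps s))) ends

  label-bottom : ∀ {c} → c ≤ m → label (bottom c) ≡ suc (2 * c)
  label-bottom c≤m = cong (λ j → suc (2 * j)) (toℕ-clamp m c≤m)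

  label-top : ∀ {c} → c ≤ m → label (top c) ≡ suc (suc (2 * c))
  label-top c≤m = cong (λ j → suc (suc (2 * j))) (toℕ-clamp m c≤m)

  bottom-descent : ∀ h y s → T (staysBelow (suc h) s) → y + northSteps s ≡ suc m → h + y ≤ m →
                   headDescent (bottom (h + y)) (place (suc h) y s) ≡ highPeakHere h s
  bottom-descent zero    y []      _     _    _   = refl
  bottom-descent (suc h) y []      _     _    _   = refl
  bottom-descent h       y (E ∷ s) below ends c≤m =
    trans (𝟙-<ᵇ-cong (label-bottom (east-bound m (suc h) y s below ends)) (label-bottom c≤m))
          (trans (𝟙-≮ᵇ (≤⇒≯ (s≤s (*-monoʳ-≤ 2 (n≤1+n (h + y)))))) (sym (highPeakHere-E h s)))
  bottom-descent zero    y (N ∷ s) below ends c≤m =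
    trans (𝟙-<ᵇ-cong (label-top (north-bound m y s ends)) (label-bottom c≤m))
          (𝟙-≮ᵇ (≤⇒≯ (n≤1+n (suc (2 * y)))))
  bottom-descent (suc h) y (N ∷ s) below ends c≤m =
    trans (𝟙-<ᵇ-cong (label-top (north-bound m y s ends)) (label-bottom c≤m))
          (𝟙-<ᵇ (s≤s 2+2y≤2[1+h+y]))
    where
      2+2y≤2[1+h+y] : suc (suc (2 * y)) ≤ 2 * suc (h + y)
      2+2y≤2[1+h+y] = subst (_≤ 2 * suc (h + y)) (*-suc 2 y) (*-monoʳ-≤ 2 (s≤s (m≤n+m y h)))

  top-descent : ∀ h y s → T (staysBelow h s) → suc y + northSteps s ≡ suc m → y ≤ m →
                headDescent (top y) (place h (suc y) s) ≡ 0
  top-descent h y []      _     _    _   = refl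
  top-descent h y (E ∷ s) below ends y≤m =
    trans (𝟙-<ᵇ-cong (label-bottom (east-bound m h (suc y) s below ends)) (label-top y≤m))
          (𝟙-≮ᵇ (≤⇒≯ (≤-trans (n≤1+n _) (s≤s 2+2y≤2[h+1+y]))))
    where
      2+2y≤2[h+1+y] : suc (suc (2 * y)) ≤ 2 * (h + suc y)
      2+2y≤2[h+1+y] = subst (_≤ 2 * (h + suc y)) (*-suc 2 y) (*-monoʳ-≤ 2 (m≤n+m (suc y) h))
  top-descent h y (N ∷ s) below ends y≤m =
    trans (𝟙-<ᵇ-cong (label-top (north-bound m (suc y) s ends)) (label-top y≤m))
          (𝟙-≮ᵇ (≤⇒≯ (s≤s (s≤s (*-monoʳ-≤ 2 (n≤1+n y))))))

  descents-place : ∀ h y s → T (staysBelow h s) → y + northSteps s ≡ suc m →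
                   desW (place h y s) ≡ hpeaW h s
  descents-place h       y []      _     _    = refl
  descents-place h       y (E ∷ s) below ends =
    trans (desW-∷ (bottom (h + y)) (place (suc h) y s))
          (cong₂ _+_ (bottom-descent h y s below ends (east-bound m h y s below ends))
                     (descents-place (suc h) y s below ends))
  descents-place (suc h) y (N ∷ s) below ends =
    trans (desW-∷ (top y) (place h (suc y) s))
          (cong₂ _+_ (top-descent h y s below ends′ (north-bound m y s ends))
                     (descents-place h (suc y) s below ends′))
    where ends′ = trans (sym (+-suc y (northSteps s))) ends

  clamp-≼ : ∀ {c p q} (j : Fin (suc m)) → toℕ p ≤ toℕ q → c ≤ m → c ≤ toℕ j →
            T ((p , clamp m c) ≼ᵇ (q , j))
  clamp-≼ {p = p} {q} j p≤q c≤m c≤j =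
    ∧-intro {toℕ p ≤ᵇ toℕ q} (≤⇒≤ᵇ p≤q) (≤⇒≤ᵇ (subst (_≤ toℕ j) (sym (toℕ-clamp m c≤m)) c≤j))

  head-unplaced : ∀ {h y} x t → Enumerates h y (x ∷ t) → T (unplaced h y x)
  head-unplaced x t enum = 𝟙≢0⇒T (λ 𝟙≡0 → 1+n≢0 (trans (sym (occ-head x t)) (trans (enum x) 𝟙≡0)))

  Enumerates-head-minimal : ∀ {h y z} x t → Enumerates h y (x ∷ t) → T (compatible (x ∷ t)) →
                            T (unplaced h y z) → T (z ≼ᵇ x) → z ≡ x
  Enumerates-head-minimal {z = z} x t enum c z-unplaced =
    compatible-head-minimal {x = x} {z} {t} c
      (occ≢0⇒∈ (x ∷ t) (λ occ≡0 → 0≢1+n (trans (sym occ≡0) (trans (enum z) (T⇒𝟙≡1 z-unplaced)))))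

  -- The leftmost unplaced cell of a row lies below every unplaced cell of that row, so
  -- compatibility forces each row to be listed from left to right.
  head-bottom : ∀ {h y} j t → Enumerates h y ((0F , j) ∷ t) → T (compatible ((0F , j) ∷ t)) →
                h + y ≤ m × (0F , j) ≡ bottom (h + y)
  head-bottom {h} {y} j t enum c =
    c≤m , sym (Enumerates-head-minimal {z = bottom (h + y)} (0F , j) t enum c
                 (bottom-unplaced {h} {y} c≤m) (clamp-≼ {p = 0F} {0F} j z≤n c≤m c≤j))
    where
      c≤j = ≤ᵇ⇒≤ (h + y) (toℕ j) (head-unplaced (0F , j) t enum)
      c≤m = ≤-trans c≤j (toℕ≤pred[n] j)

  head-top : ∀ {h y} j t → Enumerates h y ((1F , j) ∷ t) → T (compatible ((1F , j) ∷ t)) →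
             y ≤ m × (1F , j) ≡ top y
  head-top {h} {y} j t enum c =
    y≤m , sym (Enumerates-head-minimal {z = top y} (1F , j) t enum c
                 (top-unplaced {h} y≤m) (clamp-≼ {p = 1F} {1F} j ≤-refl y≤m y≤j))
    where
      y≤j = ≤ᵇ⇒≤ y (toℕ j) (head-unplaced (1F , j) t enum)
      y≤m = ≤-trans y≤j (toℕ≤pred[n] j)

  -- On the diagonal the bottom cell of the current column is still unplaced and lies below any top cell.
  head-top-off-diagonal : ∀ {y} j t → Enumerates 0 y ((1F , j) ∷ t) →
                          T (compatible ((1F , j) ∷ t)) → ⊥
  head-top-off-diagonal {y} j t enum c =
    contradiction (Enumerates-head-minimal {z = bottom y} (1F , j) t enum c
                    (bottom-unplaced {0} {y} y≤m) (clamp-≼ {p = 0F} {1F} j z≤n y≤m y≤j)) λ ()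
    where
      y≤j = ≤ᵇ⇒≤ y (toℕ j) (head-unplaced (1F , j) t enum)
      y≤m = ≤-trans y≤j (toℕ≤pred[n] j)

  Enumerates-[] : ∀ {h y} → Enumerates h y [] → m < y
  Enumerates-[] {h} {y} enum =
    ≰⇒> λ y≤m → 0≢1+n (trans (enum (top y)) (T⇒𝟙≡1 (top-unplaced {h} y≤m)))

  rows-determine : ∀ h y xs → h + y ≤ suc m → Enumerates h y xs → T (compatible xs) →
                   xs ≡ place h y (map row xs) × T (staysBelow h (map row xs))
  rows-determine h y [] bound enum _ =
    refl , ≡⇒≡ᵇ h 0 (n≤0⇒n≡0 (+-cancelʳ-≤ y h 0 (≤-trans bound (Enumerates-[] enum))))
  rows-determine h y ((0F , j) ∷ t) bound enum c =
    cong₂ _∷_ x≡ (proj₁ rest) , proj₂ rest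
    where
      c≤m = proj₁ (head-bottom j t enum c)
      x≡  = proj₂ (head-bottom j t enum c)
      enum′ = Enumerates-tail {t = t} (removes-bottom h y c≤m)
                (subst (λ x → Enumerates h y (x ∷ t)) x≡ enum)
      rest = rows-determine (suc h) y t (s≤s c≤m) enum′ (compatible-tail (0F , j) t c)
  rows-determine zero    y ((1F , j) ∷ t) bound enum c = ⊥-elim (head-top-off-diagonal j t enum c)
  rows-determine (suc h) y ((1F , j) ∷ t) bound enum c =
    cong₂ _∷_ x≡ (proj₁ rest) , proj₂ rest
    where
      y≤m = proj₁ (head-top j t enum c)
      x≡  = proj₂ (head-top j t enum c)
      enum′ = Enumerates-tail {t = t} (removes-top h y y≤m)
                (subst (λ x → Enumerates (suc h) y (x ∷ t)) x≡ enum)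
      bound′ = subst (_≤ suc m) (sym (+-suc h y)) bound
      rest = rows-determine h (suc y) t bound′ enum′ (compatible-tail (1F , j) t c)

  module _ (w : List Cell) (p : T (isLinExt (suc m) w)) where

    rows-linExt : w ≡ place 0 0 (map row w) × T (staysBelow 0 (map row w))
    rows-linExt = rows-determine 0 0 w z≤n (λ z → trans (occ≡1 z) (sym (unplaced-origin z))) compatible-w
      where
        occ≡1        = proj₁ (isLinExt⁻ (suc m) w p)
        compatible-w = proj₂ (proj₂ (isLinExt⁻ (suc m) w p))

    rows-isDyck : T (isDyck (suc m) (map row w))
    rows-isDyck = isDyck⁺ (suc m) (map row w)
      (trans (length-map row w) (proj₁ (proj₂ (isLinExt⁻ (suc m) w p)))) (proj₂ rows-linExt)

  place-isLinExt : ∀ s → T (isDyck (suc m) s) → T (isLinExt (suc m) (place 0 0 s))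
  place-isLinExt s p = isLinExt⁺ (suc m) (place 0 0 s)
    (λ z → trans (enumerates-place 0 0 s below ends z) (unplaced-origin z))
    (trans (length-place 0 0 s) (proj₁ (isDyck⁻ (suc m) s p)))
    (compatible-place 0 0 s below ends)
    where
      below = proj₂ (isDyck⁻ (suc m) s p)
      ends  = dyck-northSteps (suc m) s p

  linExt↔dyck : LinExt (suc m) ↔ Dyck (suc m)
  linExt↔dyck = mk↔ₛ′ (λ (w , p) → map row w , rows-isDyck w p)
                      (λ (s , p) → place 0 0 s , place-isLinExt s p)
                      (λ (s , _) → subset-≡ (rows-place 0 0 s))
                      (λ (w , p) → subset-≡ (sym (proj₁ (rows-linExt w p))))

  des≡hpea : ∀ σ → des {suc m} σ ≡ hpea {suc m} (Inverse.to linExt↔dyck σ)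
  des≡hpea (w , p) = trans (cong desW (proj₁ (rows-linExt w p)))
                           (descents-place 0 0 (map row w) (proj₂ (rows-linExt w p))
                                           (dyck-northSteps (suc m) (map row w) (rows-isDyck w p)))

corollary2p2 : (n : ℕ) → 1 ≤ n → (k : ℕ) →
    (Σ (LinExt n) (λ σ → des {n} σ ≡ k)) ↔ (Σ (Dyck n) (λ D → hpea {n} D ≡ k))
corollary2p2 (suc m) _ k = Σ-↔ linExt↔dyck (λ {σ} → ≡-↔ (des≡hpea σ))
  where open Extensions m
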